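{- Let $B:\mathbb{F}_3[G]\to M$ be the $\mathbb{F}_3$-linear map with $B(g)=B_g$ for $g\in G$. Then the image of $B$ has dimension $4$ and consists of the symmetric elements whose second and third rows sum to $0$, i.e. elements of the form $$a_{00}+a_{01}(e+f)+a_{02}(e^2+f^2)+a_{11}ef-(a_{01}+a_{11})(e^2f+ef^2)+(a_{01}+a_{11}-a_{02})e^2f^2;$$ and the kernel of $B$ has dimension $5$ and is determined by the relations $B_{\tau^2}+B_\tau+B_1=0$, $B_{\sigma^2\tau}-B_{\sigma^2}-B_\tau+B_1=0$, $B_{\sigma\tau}-B_\sigma-B_\tau+B_1=0$, $B_{\sigma^2\tau^2}-B_{\sigma^2}-B_{\tau^2}+B_1=0$, $B_{\sigma\tau^2}-B_\sigma-B_{\tau^2}+B_1=0$.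
   Context: Let $\zeta$ be a primitive cube root of unity, $K=\mathbb{Q}(\zeta)$, $L=K(\sqrt[3]{\zeta},\sqrt[3]{1-\zeta^{ -1}})$ (the splitting field of $1-(1-x^3)^3$), $G=\mathrm{Gal}(L/K)\cong(\mathbb{Z}/3)^2$ generated by $\sigma,\tau$ with $\sigma(\sqrt[3]{\zeta})=\zeta\sqrt[3]{\zeta}$, $\sigma$ fixing $\sqrt[3]{1-\zeta^{ -1}}$, $\tau$ fixing $\sqrt[3]{\zeta}$, $\tau(\sqrt[3]{1-\zeta^{ -1}})=\zeta\sqrt[3]{1-\zeta^{ -1}}$. Let $M=\mathbb{F}_3[e,f]/(e^3-1,f^3-1)$; an element $\sum a_{ij}e^if^j$ is viewed as the $3\times3$ matrix $(a_{ij})$ ("rows" indexed by $i$). $M$ is identified with the Galois module $H_1(U,Y;\mathbb{F}_3)$ for $U:x^3+y^3=1$, $Y:xy=0$, and for $g\in G$, $B_g\in M^\times$ is the element by which $g$ acts; it is multiplicative in $g$, with $B_\sigma=1-(e+f)(1-e)(1-f)$ and $B_\tau=1+(e+f)-(e^2+ef+f^2)+e^2f^2$. -}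

module Defs where

open import Data.Nat using (ℕ; zero; suc)
open import Data.Fin using (Fin; zero; suc; toℕ)
open import Data.Product using (_×_; ∃-syntax)
open import Relation.Binary.PropositionalEquality using (_≡_)
open import Relation.Nullary using (yes; no)
open import Data.Fin using (_≟_)

𝔽₃ : Set
𝔽₃ = Fin 3

infixl 6 _+₃_ _-₃_
infixl 7 _*₃_

_+₃_ : 𝔽₃ → 𝔽₃ → 𝔽₃
zero +₃ y = y
suc zero +₃ zero = suc zero
suc zero +₃ suc zero = suc (suc zero)
suc zero +₃ suc (suc zero) = zero
suc (suc zero) +₃ zero = suc (suc zero)
suc (suc zero) +₃ suc zero = zero
suc (suc zero) +₃ suc (suc zero) = suc zero

-₃_ : 𝔽₃ → 𝔽₃
-₃ zero = zero
-₃ suc zero = suc (suc zero)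
-₃ suc (suc zero) = suc zero

_-₃_ : 𝔽₃ → 𝔽₃ → 𝔽₃
x -₃ y = x +₃ (-₃ y)

_*₃_ : 𝔽₃ → 𝔽₃ → 𝔽₃
zero *₃ y = zero
suc zero *₃ y = y
suc (suc zero) *₃ y = -₃ y

0F 1F : 𝔽₃
0F = zero
1F = suc zero

∑ : ∀ {n} → (Fin n → 𝔽₃) → 𝔽₃
∑ {zero} f = zero
∑ {suc n} f = f zero +₃ ∑ (λ i → f (suc i))

-- M = 𝔽₃[e,f]/(e³-1,f³-1).  An element ∑ a_ij e^i f^j is the 3×3 array
-- (a_ij), i = row index (exponent of e), j = exponent of f.
-- Exponents live in ℤ/3, which we also represent by Fin 3 (so exponent
-- arithmetic is the same mod-3 arithmetic as above).

M : Set
M = Fin 3 → Fin 3 → 𝔽₃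

infix 4 _≈M_
_≈M_ : M → M → Set
x ≈M y = ∀ i j → x i j ≡ y i j

0M 1M : M
0M i j = zero
1M zero zero = 1F
1M _ _ = zero

mono : Fin 3 → Fin 3 → M
mono i j k l with i ≟ k | j ≟ l
... | yes _ | yes _ = 1F
... | _ | _ = zero

infixl 6 _+M_ _-M_
infixl 7 _*M_ _·M_

_+M_ _-M_ : M → M → M
(x +M y) i j = x i j +₃ y i j
(x -M y) i j = x i j -₃ y i j

_·M_ : 𝔽₃ → M → M
(c ·M x) i j = c *₃ x i j

_*M_ : M → M → M
(x *M y) i j = ∑ λ k → ∑ λ l → x k l *₃ y (i -₃ k) (j -₃ l)

_^M_ : M → ℕ → M
x ^M zero = 1M
x ^M suc n = x *M (x ^M n)

e f : M
e = mono (suc zero) zero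
f = mono zero (suc zero)

Bσ : M
Bσ = 1M -M ((e +M f) *M (1M -M e) *M (1M -M f))

Bτ : M
Bτ = 1M +M (e +M f) -M (e *M e +M e *M f +M f *M f) +M (e *M e *M f *M f)

-- G = Gal(L/K) ≅ (ℤ/3)², the element σ^a τ^b indexed by (a , b).
-- Since g ↦ B_g is multiplicative, B_{σ^a τ^b} = B_σ^a B_τ^b.

Bg : Fin 3 → Fin 3 → M
Bg a b = (Bσ ^M toℕ a) *M (Bτ ^M toℕ b)

-- the group algebra 𝔽₃[G]: c a b = coefficient of σ^a τ^b
𝔽₃G : Set
𝔽₃G = Fin 3 → Fin 3 → 𝔽₃

infix 4 _≈G_
_≈G_ : 𝔽₃G → 𝔽₃G → Set
c ≈G d = ∀ a b → c a b ≡ d a b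

0G : 𝔽₃G
0G a b = zero

[_,_] : Fin 3 → Fin 3 → 𝔽₃G
[ a , b ] a' b' with a ≟ a' | b ≟ b'
... | yes _ | yes _ = 1F
... | _ | _ = zero

infixl 6 _+G_ _-G_
_+G_ _-G_ : 𝔽₃G → 𝔽₃G → 𝔽₃G
(c +G d) a b = c a b +₃ d a b
(c -G d) a b = c a b -₃ d a b

B : 𝔽₃G → M
B c i j = ∑ λ a → ∑ λ b → c a b *₃ Bg a b i j

SymRowsZero : M → Set
SymRowsZero x = (∀ i j → x i j ≡ x j i)
              × (∑ (x (suc zero)) ≡ zero)
              × (∑ (x (suc (suc zero))) ≡ zero)

two : Fin 3
two = suc (suc zero)

param : 𝔽₃ → 𝔽₃ → 𝔽₃ → 𝔽₃ → M
param a00 a01 a02 a11 =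
  (a00 ·M mono zero zero)
  +M (a01 ·M (mono (suc zero) zero +M mono zero (suc zero)))
  +M (a02 ·M (mono two zero +M mono zero two))
  +M (a11 ·M mono (suc zero) (suc zero))
  -M ((a01 +₃ a11) ·M (mono two (suc zero) +M mono (suc zero) two))
  +M ((a01 +₃ a11 -₃ a02) ·M mono two two)

rel : Fin 5 → 𝔽₃G
rel zero = [ zero , two ] +G [ zero , suc zero ] +G [ zero , zero ]
rel (suc zero) = [ two , suc zero ] -G [ two , zero ] -G [ zero , suc zero ] +G [ zero , zero ]
rel (suc (suc zero)) = [ suc zero , suc zero ] -G [ suc zero , zero ] -G [ zero , suc zero ] +G [ zero , zero ]
rel (suc (suc (suc zero))) = [ two , two ] -G [ two , zero ] -G [ zero , two ] +G [ zero , zero ]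
rel (suc (suc (suc (suc zero)))) = [ suc zero , two ] -G [ suc zero , zero ] -G [ zero , two ] +G [ zero , zero ]

relComb : (Fin 5 → 𝔽₃) → 𝔽₃G
relComb λs a b = ∑ λ k → λs k *₃ rel k a b

-- Since B is linear and B_{σ^a τ^b} = B_σ^a B_τ^b, everything is a finite computation with the
-- nine matrices of Btable. The last four relations are the only ones involving σ²τ, στ, σ²τ², στ²
-- respectively, and once their coefficients are known the coefficient of τ² determines that of
-- the first; reading off these five coefficients (relCoeffs) is a left inverse of relComb. Hence
-- the relations are independent and 𝔽₃[G] is their span plus the elements supported on
-- 1, σ, σ², τ. The relations lie in the kernel, and on that complement B is injective, with image
-- the displayed four-parameter family, which is exactly the space of symmetric matrices whose
-- second and third rows sum to 0.

module Submission where

open import Defs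
open import Data.Nat using (zero; suc)
open import Data.Fin using (Fin; zero; suc; toℕ; _≟_)
open import Data.Fin.Properties using (all?)
open import Data.Product using (_×_; ∃-syntax; _,_)
open import Data.Vec.Functional using ([]; _∷_)
open import Relation.Binary.PropositionalEquality
  using (_≡_; refl; sym; trans; cong; cong₂; module ≡-Reasoning)
open import Relation.Nullary.Decidable using (Dec; from-yes; _×-dec_; _→-dec_)

pattern 𝟎 = zero
pattern 𝟏 = suc 𝟎
pattern 𝟐 = suc 𝟏
pattern 𝟑 = suc 𝟐
pattern 𝟒 = suc 𝟑

_≟M_ : (x y : M) → Dec (x ≈M y)
x ≟M y = all? λ i → all? λ j → x i j ≟ y i j

_≟G_ : (c d : 𝔽₃G) → Dec (c ≈G d)
_≟G_ = _≟M_

symRowsZero? : (x : M) → Dec (SymRowsZero x)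
symRowsZero? x = (all? λ i → all? λ j → x i j ≟ x j i) ×-dec (∑ (x 𝟏) ≟ 0F) ×-dec (∑ (x 𝟐) ≟ 0F)

+₃-identityʳ : ∀ x → x +₃ 0F ≡ x
+₃-identityʳ = from-yes (all? λ x → x +₃ 0F ≟ x)

+₃-interchange : ∀ a b c d → (a +₃ b) +₃ (c +₃ d) ≡ (a +₃ c) +₃ (b +₃ d)
+₃-interchange = from-yes (all? λ a → all? λ b → all? λ c → all? λ d →
  (a +₃ b) +₃ (c +₃ d) ≟ (a +₃ c) +₃ (b +₃ d))

*₃-distribʳ-+₃ : ∀ x y z → (x +₃ y) *₃ z ≡ x *₃ z +₃ y *₃ z
*₃-distribʳ-+₃ = from-yes (all? λ x → all? λ y → all? λ z → (x +₃ y) *₃ z ≟ x *₃ z +₃ y *₃ z)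

x-x≡0 : ∀ x → x -₃ x ≡ 0F
x-x≡0 = from-yes (all? λ x → x -₃ x ≟ 0F)

y+[x-y]≡x : ∀ x y → y +₃ (x -₃ y) ≡ x
y+[x-y]≡x = from-yes (all? λ x → all? λ y → y +₃ (x -₃ y) ≟ x)

sub-distrib-sum₃ : ∀ x₁ x₂ x₃ y₁ y₂ y₃ →
  (x₁ -₃ y₁) +₃ (x₂ -₃ y₂) +₃ (x₃ -₃ y₃) ≡ (x₁ +₃ x₂ +₃ x₃) -₃ (y₁ +₃ y₂ +₃ y₃)
sub-distrib-sum₃ = from-yes (all? λ x₁ → all? λ x₂ → all? λ x₃ →
  all? λ y₁ → all? λ y₂ → all? λ y₃ →
  (x₁ -₃ y₁) +₃ (x₂ -₃ y₂) +₃ (x₃ -₃ y₃) ≟ (x₁ +₃ x₂ +₃ x₃) -₃ (y₁ +₃ y₂ +₃ y₃))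

a+[b+[c+0]]≡0⇒c≡-[a+b] : ∀ a b c → a +₃ (b +₃ (c +₃ 0F)) ≡ 0F → c ≡ -₃ (a +₃ b)
a+[b+[c+0]]≡0⇒c≡-[a+b] = from-yes (all? λ a → all? λ b → all? λ c →
  (a +₃ (b +₃ (c +₃ 0F)) ≟ 0F) →-dec (c ≟ -₃ (a +₃ b)))

a+b-c≡-[c-[a+b]] : ∀ a b c → a +₃ b -₃ c ≡ -₃ (c +₃ -₃ (a +₃ b))
a+b-c≡-[c-[a+b]] = from-yes (all? λ a → all? λ b → all? λ c → a +₃ b -₃ c ≟ -₃ (c +₃ -₃ (a +₃ b)))

∑-cong : ∀ {n} {g h : Fin n → 𝔽₃} → (∀ k → g k ≡ h k) → ∑ g ≡ ∑ h
∑-cong {zero} _ = refl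
∑-cong {suc n} g≗h = cong₂ _+₃_ (g≗h zero) (∑-cong (λ k → g≗h (suc k)))

∑-distrib-+₃ : ∀ {n} (g h : Fin n → 𝔽₃) → ∑ (λ k → g k +₃ h k) ≡ ∑ g +₃ ∑ h
∑-distrib-+₃ {zero} _ _ = refl
∑-distrib-+₃ {suc n} g h =
  trans (cong (g zero +₃ h zero +₃_) (∑-distrib-+₃ (λ k → g (suc k)) (λ k → h (suc k))))
        (+₃-interchange (g zero) (h zero) _ _)

*M-cong : ∀ {x x′ y y′ : M} → x ≈M x′ → y ≈M y′ → x *M y ≈M x′ *M y′
*M-cong x≈ y≈ i j = ∑-cong λ k → ∑-cong λ l → cong₂ _*₃_ (x≈ k l) (y≈ (i -₃ k) (j -₃ l))

^M-cong : ∀ {x x′ : M} n → x ≈M x′ → x ^M n ≈M x′ ^M n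
^M-cong zero    _  _ _ = refl
^M-cong (suc n) x≈ = *M-cong x≈ (^M-cong n x≈)

B-cong : ∀ {c d} → c ≈G d → B c ≈M B d
B-cong c≈d i j = ∑-cong λ a → ∑-cong λ b → cong (_*₃ Bg a b i j) (c≈d a b)

B-+ : ∀ c d → B (c +G d) ≈M B c +M B d
B-+ c d i j = begin
  ∑ (λ a → ∑ λ b → (c a b +₃ d a b) *₃ Bg a b i j)
    ≡⟨ ∑-cong (λ a → ∑-cong λ b → *₃-distribʳ-+₃ (c a b) (d a b) (Bg a b i j)) ⟩
  ∑ (λ a → ∑ λ b → c a b *₃ Bg a b i j +₃ d a b *₃ Bg a b i j)
    ≡⟨ ∑-cong (λ a → ∑-distrib-+₃ (λ b → c a b *₃ Bg a b i j) (λ b → d a b *₃ Bg a b i j)) ⟩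
  ∑ (λ a → (∑ λ b → c a b *₃ Bg a b i j) +₃ (∑ λ b → d a b *₃ Bg a b i j))
    ≡⟨ ∑-distrib-+₃ (λ a → ∑ λ b → c a b *₃ Bg a b i j) (λ a → ∑ λ b → d a b *₃ Bg a b i j) ⟩
  B c i j +₃ B d i j ∎
  where open ≡-Reasoning

Btable : Fin 3 → Fin 3 → M
Btable 𝟎 𝟎 = (𝟏 ∷ 𝟎 ∷ 𝟎 ∷ []) ∷ (𝟎 ∷ 𝟎 ∷ 𝟎 ∷ []) ∷ (𝟎 ∷ 𝟎 ∷ 𝟎 ∷ []) ∷ []
Btable 𝟎 𝟏 = (𝟏 ∷ 𝟏 ∷ 𝟐 ∷ []) ∷ (𝟏 ∷ 𝟐 ∷ 𝟎 ∷ []) ∷ (𝟐 ∷ 𝟎 ∷ 𝟏 ∷ []) ∷ []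
Btable 𝟎 𝟐 = (𝟏 ∷ 𝟐 ∷ 𝟏 ∷ []) ∷ (𝟐 ∷ 𝟏 ∷ 𝟎 ∷ []) ∷ (𝟏 ∷ 𝟎 ∷ 𝟐 ∷ []) ∷ []
Btable 𝟏 𝟎 = (𝟏 ∷ 𝟐 ∷ 𝟏 ∷ []) ∷ (𝟐 ∷ 𝟐 ∷ 𝟐 ∷ []) ∷ (𝟏 ∷ 𝟐 ∷ 𝟎 ∷ []) ∷ []
Btable 𝟏 𝟏 = (𝟏 ∷ 𝟎 ∷ 𝟎 ∷ []) ∷ (𝟎 ∷ 𝟏 ∷ 𝟐 ∷ []) ∷ (𝟎 ∷ 𝟐 ∷ 𝟏 ∷ []) ∷ []
Btable 𝟏 𝟐 = (𝟏 ∷ 𝟏 ∷ 𝟐 ∷ []) ∷ (𝟏 ∷ 𝟎 ∷ 𝟐 ∷ []) ∷ (𝟐 ∷ 𝟐 ∷ 𝟐 ∷ []) ∷ []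
Btable 𝟐 𝟎 = (𝟐 ∷ 𝟐 ∷ 𝟎 ∷ []) ∷ (𝟐 ∷ 𝟐 ∷ 𝟐 ∷ []) ∷ (𝟎 ∷ 𝟐 ∷ 𝟏 ∷ []) ∷ []
Btable 𝟐 𝟏 = (𝟐 ∷ 𝟎 ∷ 𝟐 ∷ []) ∷ (𝟎 ∷ 𝟏 ∷ 𝟐 ∷ []) ∷ (𝟐 ∷ 𝟐 ∷ 𝟐 ∷ []) ∷ []
Btable 𝟐 𝟐 = (𝟐 ∷ 𝟏 ∷ 𝟏 ∷ []) ∷ (𝟏 ∷ 𝟎 ∷ 𝟐 ∷ []) ∷ (𝟏 ∷ 𝟐 ∷ 𝟎 ∷ []) ∷ []

Bg≈Btable : ∀ a b → Bg a b ≈M Btable a b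
Bg≈Btable a b i j = trans (*M-cong (^M-cong (toℕ a) Bσ≈) (^M-cong (toℕ b) Bτ≈) i j) (powers a b i j)
  where
  Bσ≈ : Bσ ≈M Btable 𝟏 𝟎
  Bσ≈ = from-yes (Bσ ≟M Btable 𝟏 𝟎)
  Bτ≈ : Bτ ≈M Btable 𝟎 𝟏
  Bτ≈ = from-yes (Bτ ≟M Btable 𝟎 𝟏)
  powers : ∀ a b → (Btable 𝟏 𝟎 ^M toℕ a) *M (Btable 𝟎 𝟏 ^M toℕ b) ≈M Btable a b
  powers = from-yes (all? λ a → all? λ b →
    ((Btable 𝟏 𝟎 ^M toℕ a) *M (Btable 𝟎 𝟏 ^M toℕ b)) ≟M Btable a b)

-- Reading B_g off the table instead of computing powers keeps the exhaustive checks below cheap.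
Bᵗ : 𝔽₃G → M
Bᵗ c i j = ∑ λ a → ∑ λ b → c a b *₃ Btable a b i j

B≈Bᵗ : ∀ c → B c ≈M Bᵗ c
B≈Bᵗ c i j = ∑-cong λ a → ∑-cong λ b → cong (c a b *₃_) (Bg≈Btable a b i j)

relCoeffs : 𝔽₃G → Fin 5 → 𝔽₃
relCoeffs c = c 𝟎 𝟐 +₃ c 𝟐 𝟐 +₃ c 𝟏 𝟐 ∷ c 𝟐 𝟏 ∷ c 𝟏 𝟏 ∷ c 𝟐 𝟐 ∷ c 𝟏 𝟐 ∷ []

relCoeffs-cong : ∀ {c d} → c ≈G d → ∀ k → relCoeffs c k ≡ relCoeffs d k
relCoeffs-cong c≈d 𝟎 = cong₂ _+₃_ (cong₂ _+₃_ (c≈d 𝟎 𝟐) (c≈d 𝟐 𝟐)) (c≈d 𝟏 𝟐)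
relCoeffs-cong c≈d 𝟏 = c≈d 𝟐 𝟏
relCoeffs-cong c≈d 𝟐 = c≈d 𝟏 𝟏
relCoeffs-cong c≈d 𝟑 = c≈d 𝟐 𝟐
relCoeffs-cong c≈d 𝟒 = c≈d 𝟏 𝟐

relCoeffs-sub : ∀ c d k → relCoeffs (c -G d) k ≡ relCoeffs c k -₃ relCoeffs d k
relCoeffs-sub c d 𝟎 = sub-distrib-sum₃ (c 𝟎 𝟐) (c 𝟐 𝟐) (c 𝟏 𝟐) (d 𝟎 𝟐) (d 𝟐 𝟐) (d 𝟏 𝟐)
relCoeffs-sub c d 𝟏 = refl
relCoeffs-sub c d 𝟐 = refl
relCoeffs-sub c d 𝟑 = refl
relCoeffs-sub c d 𝟒 = refl

relCoeffs∘relComb : ∀ λs k → relCoeffs (relComb λs) k ≡ λs k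
relCoeffs∘relComb λs k = trans (inverse (λs 𝟎) (λs 𝟏) (λs 𝟐) (λs 𝟑) (λs 𝟒) k) (unfold k)
  where
  inverse : ∀ v₀ v₁ v₂ v₃ v₄ k →
    relCoeffs (relComb (v₀ ∷ v₁ ∷ v₂ ∷ v₃ ∷ v₄ ∷ [])) k ≡ (v₀ ∷ v₁ ∷ v₂ ∷ v₃ ∷ v₄ ∷ []) k
  inverse = from-yes (all? λ v₀ → all? λ v₁ → all? λ v₂ → all? λ v₃ → all? λ v₄ → all? λ k →
    relCoeffs (relComb (v₀ ∷ v₁ ∷ v₂ ∷ v₃ ∷ v₄ ∷ [])) k ≟ (v₀ ∷ v₁ ∷ v₂ ∷ v₃ ∷ v₄ ∷ []) k)
  unfold : ∀ k → (λs 𝟎 ∷ λs 𝟏 ∷ λs 𝟐 ∷ λs 𝟑 ∷ λs 𝟒 ∷ []) k ≡ λs k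
  unfold 𝟎 = refl
  unfold 𝟏 = refl
  unfold 𝟐 = refl
  unfold 𝟑 = refl
  unfold 𝟒 = refl

relComb-injective : ∀ λs → relComb λs ≈G 0G → ∀ k → λs k ≡ 0F
relComb-injective λs relComb≈0 k =
  trans (sym (relCoeffs∘relComb λs k)) (trans (relCoeffs-cong relComb≈0 k) (relCoeffs-0G k))
  where
  relCoeffs-0G : ∀ k → relCoeffs 0G k ≡ 0F
  relCoeffs-0G 𝟎 = refl
  relCoeffs-0G 𝟏 = refl
  relCoeffs-0G 𝟐 = refl
  relCoeffs-0G 𝟑 = refl
  relCoeffs-0G 𝟒 = refl

B-relComb : ∀ λs → B (relComb λs) ≈M 0M
B-relComb λs i j =
  trans (B≈Bᵗ (relComb λs) i j) (relations (λs 𝟎) (λs 𝟏) (λs 𝟐) (λs 𝟑) (λs 𝟒) i j)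
  where
  relations : ∀ v₀ v₁ v₂ v₃ v₄ → Bᵗ (relComb (v₀ ∷ v₁ ∷ v₂ ∷ v₃ ∷ v₄ ∷ [])) ≈M 0M
  relations = from-yes (all? λ v₀ → all? λ v₁ → all? λ v₂ → all? λ v₃ → all? λ v₄ →
    Bᵗ (relComb (v₀ ∷ v₁ ∷ v₂ ∷ v₃ ∷ v₄ ∷ [])) ≟M 0M)

reduced : 𝔽₃ → 𝔽₃ → 𝔽₃ → 𝔽₃ → 𝔽₃G
reduced p q r s 𝟎 𝟎 = p
reduced p q r s 𝟏 𝟎 = q
reduced p q r s 𝟐 𝟎 = r
reduced p q r s 𝟎 𝟏 = s
reduced p q r s _ _ = 0F

relCoeffs≡0⇒reduced : ∀ d → (∀ k → relCoeffs d k ≡ 0F) →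
  d ≈G reduced (d 𝟎 𝟎) (d 𝟏 𝟎) (d 𝟐 𝟎) (d 𝟎 𝟏)
relCoeffs≡0⇒reduced d d∈ker 𝟎 𝟎 = refl
relCoeffs≡0⇒reduced d d∈ker 𝟏 𝟎 = refl
relCoeffs≡0⇒reduced d d∈ker 𝟐 𝟎 = refl
relCoeffs≡0⇒reduced d d∈ker 𝟎 𝟏 = refl
relCoeffs≡0⇒reduced d d∈ker 𝟐 𝟏 = d∈ker 𝟏
relCoeffs≡0⇒reduced d d∈ker 𝟏 𝟏 = d∈ker 𝟐
relCoeffs≡0⇒reduced d d∈ker 𝟐 𝟐 = d∈ker 𝟑
relCoeffs≡0⇒reduced d d∈ker 𝟏 𝟐 = d∈ker 𝟒
relCoeffs≡0⇒reduced d d∈ker 𝟎 𝟐 = begin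
  d 𝟎 𝟐                        ≡⟨ sym (trans (+₃-identityʳ _) (+₃-identityʳ _)) ⟩
  d 𝟎 𝟐 +₃ 0F +₃ 0F            ≡⟨ sym (cong₂ (λ u v → d 𝟎 𝟐 +₃ u +₃ v) (d∈ker 𝟑) (d∈ker 𝟒)) ⟩
  d 𝟎 𝟐 +₃ d 𝟐 𝟐 +₃ d 𝟏 𝟐     ≡⟨ d∈ker 𝟎 ⟩
  0F                           ∎
  where open ≡-Reasoning

residue : 𝔽₃G → 𝔽₃G
residue c = c -G relComb (relCoeffs c)

c≈relComb+residue : ∀ c → c ≈G relComb (relCoeffs c) +G residue c
c≈relComb+residue c a b = sym (y+[x-y]≡x (c a b) (relComb (relCoeffs c) a b))

relCoeffs-residue : ∀ c k → relCoeffs (residue c) k ≡ 0F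
relCoeffs-residue c k = begin
  relCoeffs (residue c) k
    ≡⟨ relCoeffs-sub c (relComb (relCoeffs c)) k ⟩
  relCoeffs c k -₃ relCoeffs (relComb (relCoeffs c)) k
    ≡⟨ cong (λ t → relCoeffs c k -₃ t) (relCoeffs∘relComb (relCoeffs c) k) ⟩
  relCoeffs c k -₃ relCoeffs c k
    ≡⟨ x-x≡0 (relCoeffs c k) ⟩
  0F ∎
  where open ≡-Reasoning

reducedPart : 𝔽₃G → 𝔽₃G
reducedPart c = reduced (residue c 𝟎 𝟎) (residue c 𝟏 𝟎) (residue c 𝟐 𝟎) (residue c 𝟎 𝟏)

residue≈reducedPart : ∀ c → residue c ≈G reducedPart c
residue≈reducedPart c = relCoeffs≡0⇒reduced (residue c) (relCoeffs-residue c)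

B≈B∘reducedPart : ∀ c → B c ≈M B (reducedPart c)
B≈B∘reducedPart c i j = begin
  B c i j
    ≡⟨ B-cong (c≈relComb+residue c) i j ⟩
  B (relComb (relCoeffs c) +G residue c) i j
    ≡⟨ B-+ (relComb (relCoeffs c)) (residue c) i j ⟩
  B (relComb (relCoeffs c)) i j +₃ B (residue c) i j
    ≡⟨ cong (_+₃ B (residue c) i j) (B-relComb (relCoeffs c) i j) ⟩
  B (residue c) i j
    ≡⟨ B-cong (residue≈reducedPart c) i j ⟩
  B (reducedPart c) i j ∎
  where open ≡-Reasoning

B-reduced : ∀ p q r s →
  B (reduced p q r s) ≈M param (p +₃ q -₃ r +₃ s) (s -₃ q -₃ r) (q -₃ s) (-₃ (q +₃ r +₃ s))
B-reduced p q r s i j = trans (B≈Bᵗ (reduced p q r s) i j) (computed p q r s i j)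
  where
  computed : ∀ p q r s →
    Bᵗ (reduced p q r s) ≈M param (p +₃ q -₃ r +₃ s) (s -₃ q -₃ r) (q -₃ s) (-₃ (q +₃ r +₃ s))
  computed = from-yes (all? λ p → all? λ q → all? λ r → all? λ s →
    Bᵗ (reduced p q r s) ≟M param (p +₃ q -₃ r +₃ s) (s -₃ q -₃ r) (q -₃ s) (-₃ (q +₃ r +₃ s)))

B-reduced-injective : ∀ p q r s → B (reduced p q r s) ≈M 0M → reduced p q r s ≈G 0G
B-reduced-injective p q r s B≈0 =
  injective p q r s λ i j → trans (sym (B≈Bᵗ (reduced p q r s) i j)) (B≈0 i j)
  where
  injective : ∀ p q r s → Bᵗ (reduced p q r s) ≈M 0M → reduced p q r s ≈G 0G
  injective = from-yes (all? λ p → all? λ q → all? λ r → all? λ s →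
    (Bᵗ (reduced p q r s) ≟M 0M) →-dec (reduced p q r s ≟G 0G))

preimage : 𝔽₃ → 𝔽₃ → 𝔽₃ → 𝔽₃ → 𝔽₃G
preimage a₀₀ a₀₁ a₀₂ a₁₁ =
  reduced (a₀₀ +₃ a₀₁ +₃ a₀₂ +₃ a₁₁) (a₁₁ -₃ a₀₁ +₃ a₀₂) (-₃ (a₀₁ +₃ a₀₂)) (a₁₁ -₃ a₀₁)

B-preimage : ∀ a₀₀ a₀₁ a₀₂ a₁₁ → B (preimage a₀₀ a₀₁ a₀₂ a₁₁) ≈M param a₀₀ a₀₁ a₀₂ a₁₁
B-preimage a₀₀ a₀₁ a₀₂ a₁₁ i j =
  trans (B≈Bᵗ (preimage a₀₀ a₀₁ a₀₂ a₁₁) i j) (computed a₀₀ a₀₁ a₀₂ a₁₁ i j)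
  where
  computed : ∀ a₀₀ a₀₁ a₀₂ a₁₁ → Bᵗ (preimage a₀₀ a₀₁ a₀₂ a₁₁) ≈M param a₀₀ a₀₁ a₀₂ a₁₁
  computed = from-yes (all? λ a₀₀ → all? λ a₀₁ → all? λ a₀₂ → all? λ a₁₁ →
    Bᵗ (preimage a₀₀ a₀₁ a₀₂ a₁₁) ≟M param a₀₀ a₀₁ a₀₂ a₁₁)

SymRowsZero-resp : ∀ {x y} → x ≈M y → SymRowsZero x → SymRowsZero y
SymRowsZero-resp {x} {y} x≈y (symmetric , row₁ , row₂) =
  (λ i j → trans (sym (x≈y i j)) (trans (symmetric i j) (x≈y j i))) ,
  trans (∑-cong λ j → sym (x≈y 𝟏 j)) row₁ ,
  trans (∑-cong λ j → sym (x≈y 𝟐 j)) row₂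

param-symRowsZero : ∀ a₀₀ a₀₁ a₀₂ a₁₁ → SymRowsZero (param a₀₀ a₀₁ a₀₂ a₁₁)
param-symRowsZero = from-yes (all? λ a₀₀ → all? λ a₀₁ → all? λ a₀₂ → all? λ a₁₁ →
  symRowsZero? (param a₀₀ a₀₁ a₀₂ a₁₁))

paramMatrix : 𝔽₃ → 𝔽₃ → 𝔽₃ → 𝔽₃ → M
paramMatrix a₀₀ a₀₁ a₀₂ a₁₁ =
  (a₀₀ ∷ a₀₁ ∷ a₀₂ ∷ []) ∷
  (a₀₁ ∷ a₁₁ ∷ -₃ (a₀₁ +₃ a₁₁) ∷ []) ∷
  (a₀₂ ∷ -₃ (a₀₁ +₃ a₁₁) ∷ a₀₁ +₃ a₁₁ -₃ a₀₂ ∷ []) ∷ []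

param≈paramMatrix : ∀ a₀₀ a₀₁ a₀₂ a₁₁ → param a₀₀ a₀₁ a₀₂ a₁₁ ≈M paramMatrix a₀₀ a₀₁ a₀₂ a₁₁
param≈paramMatrix = from-yes (all? λ a₀₀ → all? λ a₀₁ → all? λ a₀₂ → all? λ a₁₁ →
  param a₀₀ a₀₁ a₀₂ a₁₁ ≟M paramMatrix a₀₀ a₀₁ a₀₂ a₁₁)

param-injective : ∀ a₀₀ a₀₁ a₀₂ a₁₁ b₀₀ b₀₁ b₀₂ b₁₁ → param a₀₀ a₀₁ a₀₂ a₁₁ ≈M param b₀₀ b₀₁ b₀₂ b₁₁
  → (a₀₀ ≡ b₀₀) × (a₀₁ ≡ b₀₁) × (a₀₂ ≡ b₀₂) × (a₁₁ ≡ b₁₁)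
param-injective a₀₀ a₀₁ a₀₂ a₁₁ b₀₀ b₀₁ b₀₂ b₁₁ a≈b = entry 𝟎 𝟎 , entry 𝟎 𝟏 , entry 𝟎 𝟐 , entry 𝟏 𝟏
  where
  entry : ∀ i j → paramMatrix a₀₀ a₀₁ a₀₂ a₁₁ i j ≡ paramMatrix b₀₀ b₀₁ b₀₂ b₁₁ i j
  entry i j = trans (sym (param≈paramMatrix a₀₀ a₀₁ a₀₂ a₁₁ i j))
                    (trans (a≈b i j) (param≈paramMatrix b₀₀ b₀₁ b₀₂ b₁₁ i j))

symRowsZero⇒param : ∀ x → SymRowsZero x → param (x 𝟎 𝟎) (x 𝟎 𝟏) (x 𝟎 𝟐) (x 𝟏 𝟏) ≈M x
symRowsZero⇒param x (symmetric , row₁ , row₂) i j =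
  trans (param≈paramMatrix (x 𝟎 𝟎) (x 𝟎 𝟏) (x 𝟎 𝟐) (x 𝟏 𝟏) i j) (entry i j)
  where
  x₁₂ : -₃ (x 𝟎 𝟏 +₃ x 𝟏 𝟏) ≡ x 𝟏 𝟐
  x₁₂ = trans (cong (λ t → -₃ (t +₃ x 𝟏 𝟏)) (symmetric 𝟎 𝟏))
              (sym (a+[b+[c+0]]≡0⇒c≡-[a+b] (x 𝟏 𝟎) (x 𝟏 𝟏) (x 𝟏 𝟐) row₁))
  x₂₂ : x 𝟎 𝟏 +₃ x 𝟏 𝟏 -₃ x 𝟎 𝟐 ≡ x 𝟐 𝟐
  x₂₂ = trans (a+b-c≡-[c-[a+b]] (x 𝟎 𝟏) (x 𝟏 𝟏) (x 𝟎 𝟐))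
         (trans (cong₂ (λ u v → -₃ (u +₃ v)) (symmetric 𝟎 𝟐) (trans x₁₂ (symmetric 𝟏 𝟐)))
                (sym (a+[b+[c+0]]≡0⇒c≡-[a+b] (x 𝟐 𝟎) (x 𝟐 𝟏) (x 𝟐 𝟐) row₂)))
  entry : ∀ i j → paramMatrix (x 𝟎 𝟎) (x 𝟎 𝟏) (x 𝟎 𝟐) (x 𝟏 𝟏) i j ≡ x i j
  entry 𝟎 𝟎 = refl
  entry 𝟎 𝟏 = refl
  entry 𝟎 𝟐 = refl
  entry 𝟏 𝟏 = refl
  entry 𝟏 𝟎 = symmetric 𝟎 𝟏
  entry 𝟐 𝟎 = symmetric 𝟎 𝟐
  entry 𝟏 𝟐 = x₁₂
  entry 𝟐 𝟏 = trans x₁₂ (symmetric 𝟏 𝟐)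
  entry 𝟐 𝟐 = x₂₂

B-reduced-symRowsZero : ∀ p q r s → SymRowsZero (B (reduced p q r s))
B-reduced-symRowsZero p q r s = SymRowsZero-resp (λ i j → sym (B-reduced p q r s i j))
  (param-symRowsZero (p +₃ q -₃ r +₃ s) (s -₃ q -₃ r) (q -₃ s) (-₃ (q +₃ r +₃ s)))

B-symRowsZero : ∀ c → SymRowsZero (B c)
B-symRowsZero c = SymRowsZero-resp (λ i j → sym (B≈B∘reducedPart c i j))
  (B-reduced-symRowsZero (residue c 𝟎 𝟎) (residue c 𝟏 𝟎) (residue c 𝟐 𝟎) (residue c 𝟎 𝟏))

symRowsZero⇒image : ∀ x → SymRowsZero x → ∃[ c ] B c ≈M x
symRowsZero⇒image x x∈ = preimage (x 𝟎 𝟎) (x 𝟎 𝟏) (x 𝟎 𝟐) (x 𝟏 𝟏) ,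
  λ i j → trans (B-preimage (x 𝟎 𝟎) (x 𝟎 𝟏) (x 𝟎 𝟐) (x 𝟏 𝟏) i j) (symRowsZero⇒param x x∈ i j)

kernel⇒relComb : ∀ c → B c ≈M 0M → c ≈G relComb (relCoeffs c)
kernel⇒relComb c Bc≈0 a b = begin
  c a b                                                 ≡⟨ c≈relComb+residue c a b ⟩
  relComb (relCoeffs c) a b +₃ residue c a b            ≡⟨ cong (relComb (relCoeffs c) a b +₃_) residue≡0 ⟩
  relComb (relCoeffs c) a b +₃ 0F                       ≡⟨ +₃-identityʳ _ ⟩
  relComb (relCoeffs c) a b                             ∎
  where
  open ≡-Reasoning
  residue≡0 : residue c a b ≡ 0F
  residue≡0 = trans (residue≈reducedPart c a b)
    (B-reduced-injective _ _ _ _ (λ i j → trans (sym (B≈B∘reducedPart c i j)) (Bc≈0 i j)) a b)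

lemma7p1 :
      -- image of B = symmetric elements whose 2nd and 3rd rows sum to 0
      (∀ (x : M) → ((∃[ c ] B c ≈M x) → SymRowsZero x) × (SymRowsZero x → ∃[ c ] B c ≈M x))
      -- these are exactly the elements of the displayed form
      × (∀ (x : M) → (SymRowsZero x → ∃[ a00 ] ∃[ a01 ] ∃[ a02 ] ∃[ a11 ] param a00 a01 a02 a11 ≈M x)
                    × ((∃[ a00 ] ∃[ a01 ] ∃[ a02 ] ∃[ a11 ] param a00 a01 a02 a11 ≈M x) → SymRowsZero x))
      -- the parametrisation by 𝔽₃⁴ is injective, so the image has dimension 4
      × (∀ a00 a01 a02 a11 b00 b01 b02 b11 → param a00 a01 a02 a11 ≈M param b00 b01 b02 b11
           → (a00 ≡ b00) × (a01 ≡ b01) × (a02 ≡ b02) × (a11 ≡ b11))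
      -- the kernel of B is the span of the five relations
      × (∀ (c : 𝔽₃G) → ((B c ≈M 0M) → ∃[ λs ] c ≈G relComb λs) × ((∃[ λs ] c ≈G relComb λs) → B c ≈M 0M))
      -- and the five relations are linearly independent, so the kernel has dimension 5
      × (∀ (λs : Fin 5 → 𝔽₃) → relComb λs ≈G 0G → ∀ k → λs k ≡ 0F)
lemma7p1 =
    (λ x → (λ { (c , Bc≈x) → SymRowsZero-resp Bc≈x (B-symRowsZero c) }) , symRowsZero⇒image x)
  , (λ x → (λ x∈ → x 𝟎 𝟎 , x 𝟎 𝟏 , x 𝟎 𝟐 , x 𝟏 𝟏 , symRowsZero⇒param x x∈)
         , λ { (a₀₀ , a₀₁ , a₀₂ , a₁₁ , param≈x) →
                 SymRowsZero-resp param≈x (param-symRowsZero a₀₀ a₀₁ a₀₂ a₁₁) })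
  , param-injective
  , (λ c → (λ Bc≈0 → relCoeffs c , kernel⇒relComb c Bc≈0)
         , λ { (λs , c≈relComb) i j → trans (B-cong c≈relComb i j) (B-relComb λs i j) })
  , relComb-injective
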